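{- Let $G=(V,E)$ be a finite connected loopless graph with edge lengths $\ell\colon E\to\mathbb{Z}_{>0}$, let $\mathfrak{m}\in C^1(G,\mathbb{Z})$, and let $f_1,f_2\in C^0(G,\mathbb{Z})$ with $G^\mathfrak{m}_{f_1}$ and $G^\mathfrak{m}_{f_2}$ connected. Let $X_1,\dots,X_q\subseteq V$ be the level sets of $f_2-f_1$, in increasing order of the value. Let $D_1$ be the set of oriented edges of $G^\mathfrak{m}_{f_1}$ going from $X_i$ to $X_j$ with $i<j$, and $D_2$ the set of oriented edges of $G^\mathfrak{m}_{f_2}$ going from $X_j$ to $X_i$ with $i<j$. Then $\mathrm{Vor}^\mathfrak{m}_H(f_1)\cap\mathrm{Vor}^\mathfrak{m}_H(f_2)\neq\emptyset$ if and only if $\mathfrak{d}^\mathfrak{m}_{f_1}+\frac12\chi_{D_1}=\mathfrak{d}^\mathfrak{m}_{f_2}+\frac12\chi_{D_2}$. Furthermore, in this case $\mathfrak{f}_1=\mathfrak{f}_2=\mathrm{Vor}^\mathfrak{m}_H(f_1)\cap\mathrm{Vor}^\mathfrak{m}_H(f_2)$, where $\mathfrak{f}_i$ is the face of $\mathrm{Vor}^\mathfrak{m}_H(f_i)$ corresponding to $D_i$.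
   Context: $\mathbb{E}$: oriented edges ($e=uv$: tail $u$, head $v$); $C^0(G,A)$ = functions $V\to A$; $C^1(G,A)$ = $x\colon\mathbb{E}\to A$ with $x_{\bar e}=-x_e$; $d^*(x)(v)=\sum_{e:\ \mathrm{head}(e)=v}x_e$. For $f\in C^0(G,\mathbb{Z})$ and $e=uv$ put $a_e=f(v)-f(u)+\mathfrak{m}_e$; $\mathfrak{d}^\mathfrak{m}_f(e)=a_e/\ell_e$ if $\ell_e\mid a_e$, else $\lfloor a_e/\ell_e\rfloor+\frac12$; $G^\mathfrak{m}_f$ is the spanning subgraph with edges those $e$ with $\ell_e\mid a_e$; $\square^\mathfrak{m}_f=\{\mathfrak{d}^\mathfrak{m}_f+\epsilon:|\epsilon_e|\le\frac12\ \forall e,\ \epsilon_e=0\text{ for }e\notin G^\mathfrak{m}_f\}$; $\mathrm{Vor}^\mathfrak{m}_H(f)=d^*(\square^\mathfrak{m}_f)$. For a set $D$ of oriented edges containing no pair $e,\bar e$, $\chi_D\in C^1(G,\mathbb{Z})$ is $+1$ on $D$, $-1$ on reverses of elements of $D$, $0$ elsewhere. The face of $\mathrm{Vor}^\mathfrak{m}_H(f_i)$ corresponding to $D_i$ is $\mathfrak{f}_i=d^*\big(\mathfrak{d}^\mathfrak{m}_{f_i}+\frac12\chi_{D_i}+Q_i\big)$, where $Q_i=\{\epsilon\in C^1(G,\mathbb{R}):|\epsilon_e|\le\frac12\ \forall e,\ \epsilon_e=0$ unless $e$ is an edge of $G^\mathfrak{m}_{f_i}$ with both endpoints in the same $X_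k\}$.
   Formalization: The perturbations ε in $\square^\mathfrak{m}_f$ and $Q_i$ are rational rather than real, so the sets $\mathrm{Vor}^\mathfrak{m}_H(f_i)$ and the faces $\mathfrak{f}_i$ consist of rational points. -}

module Defs where

open import Data.Nat as ℕ using (ℕ; zero; suc; NonZero)
open import Data.Nat.Divisibility using (_∣?_)
open import Data.Integer as ℤ using (ℤ; +_)
open import Data.Integer.Divisibility as ℤD using ()
open import Data.Rational as ℚ using (ℚ; 0ℚ; 1ℚ; ½; floor)
open import Data.Fin using (Fin; zero; suc)
open import Data.Bool using (Bool; true; false; if_then_else_)
open import Data.Product using (Σ; _×_; _,_)
open import Relation.Nullary using (¬_; does)
open import Relation.Binary.PropositionalEquality using (_≡_; _≢_)

-- Edges: Fin m; edge e has a fixed reference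
-- orientation src e → tgt e.  An oriented edge is (e , true) = src→tgt
-- or (e , false) = tgt→src (the reverse ē).

record MetricGraph : Set where
  field
    n        : ℕ
    m        : ℕ
    src tgt  : Fin m → Fin n
    loopless : ∀ e → src e ≢ tgt e
    ℓ        : Fin m → ℕ
    ℓ-pos    : ∀ e → NonZero (ℓ e)

module _ (G : MetricGraph) where
  open MetricGraph G

  OEdge : Set
  OEdge = Fin m × Bool

  tail head : OEdge → Fin n
  tail (e , true)  = src e
  tail (e , false) = tgt e
  head (e , true)  = tgt e
  head (e , false) = src e

  data Reach (P : Fin m → Set) : Fin n → Fin n → Set where
    here : ∀ {u} → Reach P u u
    fwd  : ∀ {u} e → P e → Reach P (tgt e) u → Reach P (src e) u
    bwd  : ∀ {u} e → P e → Reach P (src e) u → Reach P (tgt e) u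

  ConnectedSub : (Fin m → Set) → Set
  ConnectedSub P = ∀ u v → Reach P u v

  Connected : Set
  Connected = ConnectedSub (λ _ → Fin m)

  -- Cochains.  C⁰(G,A) = Fin n → A.  An element x of C¹(G,A)
  -- (x_ē = -x_e) is represented by its values on the reference
  -- orientations, x : Fin m → A; its value on (e , false) is -(x e).
  C0 : Set → Set
  C0 A = Fin n → A

  C1 : Set → Set
  C1 A = Fin m → A

  sumℚ : (k : ℕ) → (Fin k → ℚ) → ℚ
  sumℚ zero    g = 0ℚ
  sumℚ (suc k) g = g zero ℚ.+ sumℚ k (λ i → g (suc i))

  at : C1 ℚ → OEdge → ℚ
  at x (e , true)  = x e
  at x (e , false) = ℚ.- (x e)

  -- d*(x)(v) = Σ_{oriented e, head e = v} x_e.  Each edge contributes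
  -- its reference orientation if tgt e = v and its reverse if src e = v.
  ind : Fin n → Fin n → ℚ → ℚ
  ind v w q with v Data.Fin.≟ w
  ... | Relation.Nullary.yes _ = q
  ... | Relation.Nullary.no  _ = 0ℚ

  d* : C1 ℚ → C0 ℚ
  d* x v = sumℚ m (λ e → ind v (tgt e) (at x (e , true))
                       ℚ.+ ind v (src e) (at x (e , false)))

  aₑ : C1 ℤ → C0 ℤ → Fin m → ℤ
  aₑ 𝔪 f e = (f (tgt e) ℤ.- f (src e)) ℤ.+ 𝔪 e

  -- e is an edge of G^𝔪_f  iff  ℓ_e ∣ a_e  (integer divisibility)
  InG : C1 ℤ → C0 ℤ → Fin m → Set
  InG 𝔪 f e = (+ ℓ e) ℤD.∣ aₑ 𝔪 f e

  𝔡 : C1 ℤ → C0 ℤ → C1 ℚ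
  𝔡 𝔪 f e =
    let instance _ = ℓ-pos e
        q = aₑ 𝔪 f e ℚ./ ℓ e
    in if does (ℓ e ∣? ℤ.∣ aₑ 𝔪 f e ∣)
         then q
         else (floor q ℚ./ 1) ℚ.+ ½

  -- χ_D for a set D ⊆ 𝔼 (given as a Boolean predicate, containing no
  -- pair e, ē), on reference orientations.
  χ : (OEdge → Bool) → C1 ℚ
  χ D e = if D (e , true) then 1ℚ
          else (if D (e , false) then ℚ.- 1ℚ else 0ℚ)

  InImage : C1 ℚ → (Fin m → Set) → C0 ℚ → Set
  InImage c Allowed y =
    Σ (C1 ℚ) λ ε → (∀ e → ℚ.∣ ε e ∣ ℚ.≤ ½)
                 × (∀ e → ¬ Allowed e → ε e ≡ 0ℚ)
                 × (∀ v → y v ≡ d* (λ e → c e ℚ.+ ε e) v)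

  Vor : C1 ℤ → C0 ℤ → C0 ℚ → Set
  Vor 𝔪 f = InImage (𝔡 𝔪 f) (InG 𝔪 f)

  -- g = f₂ - f₁; the level sets X_1,…,X_q are ordered by value of g, so
  -- "from X_i to X_j with i<j" means g(tail) < g(head).
  D₁ : C1 ℤ → C0 ℤ → C0 ℤ → OEdge → Bool
  D₁ 𝔪 f₁ f₂ o =
    does (ℓ (Data.Product.proj₁ o) ∣? ℤ.∣ aₑ 𝔪 f₁ (Data.Product.proj₁ o) ∣)
    Data.Bool.∧ does ((f₂ (tail o) ℤ.- f₁ (tail o)) ℤ.<? (f₂ (head o) ℤ.- f₁ (head o)))

  D₂ : C1 ℤ → C0 ℤ → C0 ℤ → OEdge → Bool
  D₂ 𝔪 f₁ f₂ o =
    does (ℓ (Data.Product.proj₁ o) ∣? ℤ.∣ aₑ 𝔪 f₂ (Data.Product.proj₁ o) ∣)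
    Data.Bool.∧ does ((f₂ (head o) ℤ.- f₁ (head o)) ℤ.<? (f₂ (tail o) ℤ.- f₁ (tail o)))

  shifted : C1 ℤ → C0 ℤ → (OEdge → Bool) → C1 ℚ
  shifted 𝔪 f D e = 𝔡 𝔪 f e ℚ.+ (½ ℚ.* χ D e)

  Face : C1 ℤ → C0 ℤ → (OEdge → Bool) → C0 ℤ → C0 ℤ → C0 ℚ → Set
  Face 𝔪 f D f₁ f₂ =
    InImage (shifted 𝔪 f D)
            (λ e → InG 𝔪 f e × (f₂ (src e) ℤ.- f₁ (src e) ≡ f₂ (tgt e) ℤ.- f₁ (tgt e)))

{-# OPTIONS --safe #-}
module Submission where

-- Put g = f₂ − f₁ and aᵢ(e) = fᵢ(tgt e) − fᵢ(src e) + 𝔪ₑ, so that a₂(e) − a₁(e) = g(tgt e) − g(src e).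
-- On an edge with a = aᵢ(e) the admissible values 𝔡ᵐ_{fᵢ}(e) + εₑ fill the interval [lo a, hi a], where
-- hi a = ⌊a/ℓₑ⌋ + ½ and lo a = ⌈a/ℓₑ⌉ − ½; hence hi a ≤ lo b whenever a < b.
-- Let y = d*x₁ = d*x₂ with xᵢ ∈ □ᵐ_{fᵢ}.  On an edge along which g increases, a₁(e) < a₂(e), so
-- x₁(e) ≤ hi a₁(e) ≤ lo a₂(e) ≤ x₂(e), and symmetrically where g decreases; thus every term of
-- Σₑ (dg)ₑ x₁(e) is at most the corresponding term of Σₑ (dg)ₑ x₂(e).  Both sums equal Σᵥ g(v) y(v), so
-- all terms agree, which squeezes x₁(e) = x₂(e) onto the common endpoint hi = lo: the value of
-- 𝔡ᵐ_{fᵢ} + ½χ_{Dᵢ} on e.  On an edge inside a level set a₁ = a₂, so the two cells agree there.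

open import Algebra.Bundles using (AbelianGroup; CommutativeRing)
import Algebra.Properties.Group as GroupProperties
open import Data.Bool using (Bool; true; false; _∧_; if_then_else_)
import Data.Bool.Properties as 𝔹P
open import Data.Empty using (⊥-elim)
open import Data.Fin using (Fin; zero; suc; _≟_)
open import Data.Fin.Properties using (punchInᵢ≢i)
open import Data.Integer as ℤ using (ℤ; +_)
import Data.Integer.DivMod as ℤ
import Data.Integer.Divisibility.Signed as ℤS
import Data.Integer.Properties as ℤP
import Data.Integer.Tactic.RingSolver as ℤSolver
open import Data.Nat as ℕ using (ℕ; zero; suc; NonZero)
open import Data.Nat.Divisibility using (_∣?_) renaming (_∣_ to _∣ℕ_)
open import Data.Product using (Σ; _×_; _,_; proj₁; proj₂)
open import Data.Rational as ℚ using (ℚ; mkℚ; 0ℚ; 1ℚ; ½; floor; toℚᵘ)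
import Data.Rational.Properties as ℚP
open import Data.Rational.Solver using (module +-*-Solver)
import Data.Rational.Unnormalised as ℚᵘ
import Data.Rational.Unnormalised.Properties as ℚᵘP
open import Data.Sum using (_⊎_; inj₁; inj₂)
open import Data.Vec.Functional using (removeAt)
open import Function.Base using (_∘_)
open import Function.Bundles using (_⇔_; mk⇔; Equivalence)
open import Function.Construct.Composition using (_⇔-∘_)
open import Function.Construct.Symmetry using (⇔-sym)
open import Relation.Binary.Definitions using (tri<; tri≈; tri>)
open import Relation.Binary.PropositionalEquality
open import Relation.Nullary using (¬_; Dec; yes; no; does)
open import Relation.Nullary.Decidable using (dec-true; dec-false)

open import Algebra.Properties.Group ℚP.+-0-group using (⁻¹-involutive)
open import Algebra.Properties.Semiring.Sum (CommutativeRing.semiring ℚP.+-*-commutativeRing)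
  using (sum; sum-cong-≗; ∑-distrib-+; ∑-comm; *-distribˡ-sum; sum-remove; sum-replicate-zero)
open +-*-Solver using (solve; _:+_; _:*_; :-_; _:-_; _:=_; con)

open import Defs

-- Integers and rationals

ι : ℤ → ℚ
ι i = i ℚ./ 1

toℚᵘ-/ : ∀ a b .{{_ : NonZero b}} → toℚᵘ (a ℚ./ b) ℚᵘ.≃ ℚᵘ.mkℚᵘ a (ℕ.pred b)
toℚᵘ-/ a (suc b) = ℚP.toℚᵘ-fromℚᵘ (ℚᵘ.mkℚᵘ a b)

/-≤-cross : ∀ i j n k .{{_ : NonZero n}} .{{_ : NonZero k}} →
            i ℤ.* + k ℤ.≤ j ℤ.* + n → i ℚ./ n ℚ.≤ j ℚ./ k
/-≤-cross i j n@(suc _) k@(suc _) ik≤jn = ℚP.toℚᵘ-cancel-≤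
  (ℚᵘP.≤-respˡ-≃ (ℚᵘP.≃-sym (toℚᵘ-/ i n)) (ℚᵘP.≤-respʳ-≃ (ℚᵘP.≃-sym (toℚᵘ-/ j k)) (ℚᵘ.*≤* ik≤jn)))

/-<-cross : ∀ i j n k .{{_ : NonZero n}} .{{_ : NonZero k}} →
            i ℤ.* + k ℤ.< j ℤ.* + n → i ℚ./ n ℚ.< j ℚ./ k
/-<-cross i j n@(suc _) k@(suc _) ik<jn = ℚP.toℚᵘ-cancel-<
  (ℚᵘP.<-respˡ-≃ (ℚᵘP.≃-sym (toℚᵘ-/ i n)) (ℚᵘP.<-respʳ-≃ (ℚᵘP.≃-sym (toℚᵘ-/ j k)) (ℚᵘ.*<* ik<jn)))

/-≡-cross : ∀ i j n k .{{_ : NonZero n}} .{{_ : NonZero k}} →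
            i ℤ.* + k ≡ j ℤ.* + n → i ℚ./ n ≡ j ℚ./ k
/-≡-cross i j (suc n) (suc k) ik≡jn = ℚP.fromℚᵘ-cong {ℚᵘ.mkℚᵘ i n} {ℚᵘ.mkℚᵘ j k} (ℚᵘ.*≡* ik≡jn)

ι-mono-≤ : ∀ {i j} → i ℤ.≤ j → ι i ℚ.≤ ι j
ι-mono-≤ {i} {j} i≤j =
  /-≤-cross i j 1 1 (subst₂ ℤ._≤_ (sym (ℤP.*-identityʳ i)) (sym (ℤP.*-identityʳ j)) i≤j)

ι-mono-< : ∀ {i j} → i ℤ.< j → ι i ℚ.< ι j
ι-mono-< {i} {j} i<j =
  /-<-cross i j 1 1 (subst₂ ℤ._<_ (sym (ℤP.*-identityʳ i)) (sym (ℤP.*-identityʳ j)) i<j)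

ι-cancel-< : ∀ {i j} → ι i ℚ.< ι j → i ℤ.< j
ι-cancel-< ιi<ιj = ℤP.≰⇒> (λ j≤i → ℚP.<-irrefl refl (ℚP.<-≤-trans ιi<ιj (ι-mono-≤ j≤i)))

ι-homo-+ : ∀ i j → ι (i ℤ.+ j) ≡ ι i ℚ.+ ι j
ι-homo-+ i j = ℚP.toℚᵘ-injective (begin
  toℚᵘ (ι (i ℤ.+ j))                ≈⟨ toℚᵘ-/ (i ℤ.+ j) 1 ⟩
  ℚᵘ.mkℚᵘ (i ℤ.+ j) 0               ≈⟨ ℚᵘ.*≡* (cross i j) ⟩
  ℚᵘ.mkℚᵘ i 0 ℚᵘ.+ ℚᵘ.mkℚᵘ j 0      ≈⟨ ℚᵘP.+-cong (toℚᵘ-/ i 1) (toℚᵘ-/ j 1) ⟨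
  toℚᵘ (ι i) ℚᵘ.+ toℚᵘ (ι j)        ≈⟨ ℚP.toℚᵘ-homo-+ (ι i) (ι j) ⟨
  toℚᵘ (ι i ℚ.+ ι j)                ∎)
  where
  open ℚᵘP.≃-Reasoning
  cross : ∀ i j → (i ℤ.+ j) ℤ.* (+ 1 ℤ.* + 1) ≡ (i ℤ.* + 1 ℤ.+ j ℤ.* + 1) ℤ.* + 1
  cross = ℤSolver.solve-∀

/-monoˡ-< : ∀ {a b} l .{{_ : NonZero l}} → a ℤ.< b → a ℚ./ l ℚ.< b ℚ./ l
/-monoˡ-< {a} {b} l@(suc _) a<b = /-<-cross a b l l (ℤP.*-monoʳ-<-pos (+ l) a<b)

/-exact : ∀ a l .{{_ : NonZero l}} → l ∣ℕ ℤ.∣ a ∣ → Σ ℤ λ k → a ℚ./ l ≡ ι k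
/-exact a l l∣a with ℤS.∣ᵤ⇒∣ {+ l} {a} l∣a
... | ℤS.divides k a≡kl = k , /-≡-cross a k l 1 (trans (ℤP.*-identityʳ a) a≡kl)

ι⌊p⌋≤p : ∀ p → ι (floor p) ℚ.≤ p
ι⌊p⌋≤p p@(mkℚ n d-1 _) =
  subst (ι (floor p) ℚ.≤_) (ℚP.↥p/↧p≡p p) (/-≤-cross (floor p) n 1 (suc d-1) ⌊p⌋d≤n)
  where
  d = + suc d-1
  ⌊p⌋d≤n : floor p ℤ.* d ℤ.≤ n ℤ.* + 1
  ⌊p⌋d≤n = begin
    floor p ℤ.* d                 ≤⟨ ℤP.i≤j+i (floor p ℤ.* d) (+ (n ℤ.% d)) ⟩
    + (n ℤ.% d) ℤ.+ floor p ℤ.* d ≡⟨ ℤ.a≡a%n+[a/n]*n n d ⟨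
    n                             ≡⟨ ℤP.*-identityʳ n ⟨
    n ℤ.* + 1                     ∎
    where open ℤP.≤-Reasoning

p<ι[suc⌊p⌋] : ∀ p → p ℚ.< ι (ℤ.suc (floor p))
p<ι[suc⌊p⌋] p@(mkℚ n d-1 _) =
  subst (ℚ._< ι (ℤ.suc (floor p))) (ℚP.↥p/↧p≡p p) (/-<-cross n (ℤ.suc (floor p)) (suc d-1) 1 n<[1+⌊p⌋]d)
  where
  d = + suc d-1
  n<[1+⌊p⌋]d : n ℤ.* + 1 ℤ.< ℤ.suc (floor p) ℤ.* d
  n<[1+⌊p⌋]d = begin-strict
    n ℤ.* + 1                     ≡⟨ ℤP.*-identityʳ n ⟩
    n                             ≡⟨ ℤ.a≡a%n+[a/n]*n n d ⟩
    + (n ℤ.% d) ℤ.+ floor p ℤ.* d <⟨ ℤP.+-monoˡ-< (floor p ℤ.* d) (ℤ.+<+ (ℤ.n%d<d n d)) ⟩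
    d ℤ.+ floor p ℤ.* d           ≡⟨ ℤP.suc-* (floor p) d ⟨
    ℤ.suc (floor p) ℤ.* d         ∎
    where open ℤP.≤-Reasoning

ι+½≡ι[suc]-½ : ∀ k → ι k ℚ.+ ½ ≡ ι (ℤ.suc k) ℚ.- ½
ι+½≡ι[suc]-½ k = begin
  ι k ℚ.+ ½           ≡⟨ solve 1 (λ x → x :+ con ½ := (con 1ℚ :+ x) :- con ½) refl (ι k) ⟩
  (1ℚ ℚ.+ ι k) ℚ.- ½  ≡⟨ cong (ℚ._- ½) (ι-homo-+ (+ 1) k) ⟨
  ι (ℤ.suc k) ℚ.- ½   ∎
  where open ≡-Reasoning

ι+½≤ι-½ : ∀ {i j} → i ℤ.< j → ι i ℚ.+ ½ ℚ.≤ ι j ℚ.- ½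
ι+½≤ι-½ {i} {j} i<j = begin
  ι i ℚ.+ ½         ≡⟨ ι+½≡ι[suc]-½ i ⟩
  ι (ℤ.suc i) ℚ.- ½ ≤⟨ ℚP.+-monoˡ-≤ (ℚ.- ½) (ι-mono-≤ (ℤP.i<j⇒suc[i]≤j i<j)) ⟩
  ι j ℚ.- ½         ∎
  where open ℚP.≤-Reasoning

+-cancelʳ-< : ∀ {i j} k → i ℤ.+ k ℤ.< j ℤ.+ k → i ℤ.< j
+-cancelʳ-< k i+k<j+k = ℤP.≰⇒> (λ j≤i → ℤP.<⇒≱ i+k<j+k (ℤP.+-monoˡ-≤ k j≤i))

∣p∣≤q⇒-q≤p≤q : ∀ {p q} → ℚ.∣ p ∣ ℚ.≤ q → ℚ.- q ℚ.≤ p × p ℚ.≤ q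
∣p∣≤q⇒-q≤p≤q {p} {q} ∣p∣≤q with ℚP.∣p∣≡p∨∣p∣≡-p p
... | inj₁ ∣p∣≡p  = ℚP.≤-trans (ℚP.neg-antimono-≤ 0≤q) (subst (0ℚ ℚ.≤_) ∣p∣≡p (ℚP.0≤∣p∣ p))
                  , subst (ℚ._≤ q) ∣p∣≡p ∣p∣≤q
  where 0≤q = ℚP.≤-trans (ℚP.0≤∣p∣ p) ∣p∣≤q
... | inj₂ ∣p∣≡-p = subst (ℚ.- q ℚ.≤_) (⁻¹-involutive p) (ℚP.neg-antimono-≤ (subst (ℚ._≤ q) ∣p∣≡-p ∣p∣≤q))
                  , ℚP.≤-trans (subst (ℚ._≤ 0ℚ) (⁻¹-involutive p) (ℚP.neg-antimono-≤ 0≤-p)) 0≤q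
  where 0≤q  = ℚP.≤-trans (ℚP.0≤∣p∣ p) ∣p∣≤q
        0≤-p = subst (0ℚ ℚ.≤_) ∣p∣≡-p (ℚP.0≤∣p∣ p)

p<q⇒0<q-p : ∀ {p q} → p ℚ.< q → 0ℚ ℚ.< q ℚ.- p
p<q⇒0<q-p {p} {q} p<q = subst (ℚ._< q ℚ.- p) (ℚP.+-inverseʳ p) (ℚP.+-monoˡ-< (ℚ.- p) p<q)

p<q⇒p-q<0 : ∀ {p q} → p ℚ.< q → p ℚ.- q ℚ.< 0ℚ
p<q⇒p-q<0 {p} {q} p<q = subst (p ℚ.- q ℚ.<_) (ℚP.+-inverseʳ q) (ℚP.+-monoˡ-< (ℚ.- q) p<q)

*-cancelˡ-≡ : ∀ r .{{_ : ℚ.NonZero r}} {p q} → r ℚ.* p ≡ r ℚ.* q → p ≡ q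
*-cancelˡ-≡ r {p} {q} rp≡rq = begin
  p                     ≡⟨ ℚP.*-identityˡ p ⟨
  1ℚ ℚ.* p              ≡⟨ cong (ℚ._* p) (ℚP.*-inverseˡ r) ⟨
  ℚ.1/ r ℚ.* r ℚ.* p    ≡⟨ ℚP.*-assoc (ℚ.1/ r) r p ⟩
  ℚ.1/ r ℚ.* (r ℚ.* p)  ≡⟨ cong (ℚ.1/ r ℚ.*_) rp≡rq ⟩
  ℚ.1/ r ℚ.* (r ℚ.* q)  ≡⟨ ℚP.*-assoc (ℚ.1/ r) r q ⟨
  ℚ.1/ r ℚ.* r ℚ.* q    ≡⟨ cong (ℚ._* q) (ℚP.*-inverseˡ r) ⟩
  1ℚ ℚ.* q              ≡⟨ ℚP.*-identityˡ q ⟩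
  q                     ∎
  where open ≡-Reasoning

squeeze : ∀ {x h l y} → x ℚ.≤ h → h ℚ.≤ l → l ℚ.≤ y → x ≡ y → x ≡ h × l ≡ y
squeeze x≤h h≤l l≤y refl = ℚP.≤-antisym x≤h (ℚP.≤-trans h≤l l≤y) , ℚP.≤-antisym l≤y (ℚP.≤-trans x≤h h≤l)

p≤q∧r≤s∧p+r≡q+s⇒p≡q∧r≡s : ∀ {p q r s} → p ℚ.≤ q → r ℚ.≤ s → p ℚ.+ r ≡ q ℚ.+ s → p ≡ q × r ≡ s
p≤q∧r≤s∧p+r≡q+s⇒p≡q∧r≡s p≤q r≤s p+r≡q+s =
    ℚP.≤-antisym p≤q (ℚP.≮⇒≥ (λ p<q → ℚP.<-irrefl p+r≡q+s (ℚP.+-mono-<-≤ p<q r≤s)))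
  , ℚP.≤-antisym r≤s (ℚP.≮⇒≥ (λ r<s → ℚP.<-irrefl p+r≡q+s (ℚP.+-mono-≤-< p≤q r<s)))

∧-true⇒witness : ∀ {P : Set} (P? : Dec P) {b} → does P? ∧ b ≡ true → P
∧-true⇒witness (yes p) _ = p

-- Finite sums of rationals

∑-mono-≤ : ∀ {k} {f h : Fin k → ℚ} → (∀ i → f i ℚ.≤ h i) → sum f ℚ.≤ sum h
∑-mono-≤ {zero}  f≤h = ℚP.≤-refl
∑-mono-≤ {suc k} f≤h = ℚP.+-mono-≤ (f≤h zero) (∑-mono-≤ (f≤h ∘ suc))

∑-≤∧≡⇒≡ : ∀ {k} {f h : Fin k → ℚ} → (∀ i → f i ℚ.≤ h i) → sum f ≡ sum h → ∀ i → f i ≡ h i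
∑-≤∧≡⇒≡ {suc k} f≤h ∑f≡∑h i with p≤q∧r≤s∧p+r≡q+s⇒p≡q∧r≡s (f≤h zero) (∑-mono-≤ (f≤h ∘ suc)) ∑f≡∑h
∑-≤∧≡⇒≡ {suc k} f≤h ∑f≡∑h zero    | f₀≡h₀ , _ = f₀≡h₀
∑-≤∧≡⇒≡ {suc k} f≤h ∑f≡∑h (suc i) | _ , ∑f′≡∑h′ = ∑-≤∧≡⇒≡ (f≤h ∘ suc) ∑f′≡∑h′ i

sum-single : ∀ {k} (h : Fin k → ℚ) u → (∀ v → v ≢ u → h v ≡ 0ℚ) → sum h ≡ h u
sum-single {suc k} h u h≡0 = begin
  sum h                              ≡⟨ sum-remove {i = u} h ⟩
  h u ℚ.+ sum (removeAt h u)         ≡⟨ cong (h u ℚ.+_) (sum-cong-≗ (λ j → h≡0 _ (punchInᵢ≢i u j))) ⟩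
  h u ℚ.+ sum (λ (_ : Fin k) → 0ℚ)   ≡⟨ cong (h u ℚ.+_) (sum-replicate-zero k) ⟩
  h u ℚ.+ 0ℚ                         ≡⟨ ℚP.+-identityʳ (h u) ⟩
  h u                                ∎
  where open ≡-Reasoning

-- A single edge

-- For an edge e of length l and a = aₑ 𝔪 f e, the terms 𝔡 𝔪 f e and shifted 𝔪 f D e unfold to
-- 𝔡ₑ a and shiftedₑ a up down, where D (e , true) = (l ∣ a) ∧ up and D (e , false) = (l ∣ a) ∧ down.
module EdgeInterval (l : ℕ) .{{_ : NonZero l}} where

  𝔡ₑ : ℤ → ℚ
  𝔡ₑ a = if does (l ∣? ℤ.∣ a ∣) then a ℚ./ l else ι (floor (a ℚ./ l)) ℚ.+ ½

  χₑ : ℤ → Bool → Bool → ℚ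
  χₑ a up down = if does (l ∣? ℤ.∣ a ∣) ∧ up then 1ℚ
                 else (if does (l ∣? ℤ.∣ a ∣) ∧ down then ℚ.- 1ℚ else 0ℚ)

  shiftedₑ : ℤ → Bool → Bool → ℚ
  shiftedₑ a up down = 𝔡ₑ a ℚ.+ ½ ℚ.* χₑ a up down

  hi lo : ℤ → ℚ
  hi a = shiftedₑ a true false
  lo a = shiftedₑ a false true

  χₑ-flat : ∀ a → χₑ a false false ≡ 0ℚ
  χₑ-flat a rewrite 𝔹P.∧-zeroʳ (does (l ∣? ℤ.∣ a ∣)) = refl

  lo≤𝔡+ε≤hi : ∀ a {ε} → ℚ.∣ ε ∣ ℚ.≤ ½ → (¬ l ∣ℕ ℤ.∣ a ∣ → ε ≡ 0ℚ) →
              lo a ℚ.≤ 𝔡ₑ a ℚ.+ ε × 𝔡ₑ a ℚ.+ ε ℚ.≤ hi a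
  lo≤𝔡+ε≤hi a ∣ε∣≤½ ε≡0 with l ∣? ℤ.∣ a ∣
  ... | yes _ = ℚP.+-monoʳ-≤ (a ℚ./ l) (proj₁ (∣p∣≤q⇒-q≤p≤q ∣ε∣≤½))
              , ℚP.+-monoʳ-≤ (a ℚ./ l) (proj₂ (∣p∣≤q⇒-q≤p≤q ∣ε∣≤½))
  ... | no l∤a rewrite ε≡0 l∤a = ℚP.≤-refl , ℚP.≤-refl

  hi≡ι+½ : ∀ a → Σ ℤ λ u → hi a ≡ ι u ℚ.+ ½ × ι u ℚ.≤ a ℚ./ l
  hi≡ι+½ a with l ∣? ℤ.∣ a ∣
  ... | yes l∣a = let k , a/l≡k = /-exact a l l∣a
                  in k , cong (ℚ._+ ½) a/l≡k , ℚP.≤-reflexive (sym a/l≡k)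
  ... | no _    = floor (a ℚ./ l) , ℚP.+-identityʳ _ , ι⌊p⌋≤p (a ℚ./ l)

  lo≡ι-½ : ∀ b → Σ ℤ λ v → lo b ≡ ι v ℚ.- ½ × b ℚ./ l ℚ.≤ ι v
  lo≡ι-½ b with l ∣? ℤ.∣ b ∣
  ... | yes l∣b = let k , b/l≡k = /-exact b l l∣b
                  in k , cong (ℚ._- ½) b/l≡k , ℚP.≤-reflexive b/l≡k
  ... | no _    = ℤ.suc (floor (b ℚ./ l))
                , trans (ℚP.+-identityʳ _) (ι+½≡ι[suc]-½ (floor (b ℚ./ l)))
                , ℚP.<⇒≤ (p<ι[suc⌊p⌋] (b ℚ./ l))

  hi≤lo : ∀ {a b} → a ℤ.< b → hi a ℚ.≤ lo b
  hi≤lo {a} {b} a<b with hi≡ι+½ a | lo≡ι-½ b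
  ... | u , hi≡ , u≤a/l | v , lo≡ , b/l≤v = subst₂ ℚ._≤_ (sym hi≡) (sym lo≡)
    (ι+½≤ι-½ (ι-cancel-< {u} {v} (ℚP.≤-<-trans u≤a/l (ℚP.<-≤-trans (/-monoˡ-< l a<b) b/l≤v))))

-- Cochains and the sets d*(c + Q)

module _ (G : MetricGraph) where
  open MetricGraph G

  sumℚ≡sum : ∀ k (h : Fin k → ℚ) → sumℚ G k h ≡ sum h
  sumℚ≡sum zero    h = refl
  sumℚ≡sum (suc k) h = cong (h zero ℚ.+_) (sumℚ≡sum k (h ∘ suc))

  d*-term : C1 G ℚ → Fin n → Fin m → ℚ
  d*-term x v e = ind G v (tgt e) (x e) ℚ.+ ind G v (src e) (ℚ.- x e)

  d*≡sum : ∀ x v → d* G x v ≡ sum (d*-term x v)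
  d*≡sum x v = sumℚ≡sum m (d*-term x v)

  d*-cong : ∀ {x x′ : C1 G ℚ} → (∀ e → x e ≡ x′ e) → ∀ v → d* G x v ≡ d* G x′ v
  d*-cong {x} {x′} x≡x′ v = begin
    d* G x v            ≡⟨ d*≡sum x v ⟩
    sum (d*-term x v)   ≡⟨ sum-cong-≗ (λ e → cong (λ t → ind G v (tgt e) t ℚ.+ ind G v (src e) (ℚ.- t))
                                                  (x≡x′ e)) ⟩
    sum (d*-term x′ v)  ≡⟨ d*≡sum x′ v ⟨
    d* G x′ v           ∎
    where open ≡-Reasoning

  ind-refl : ∀ v q → ind G v v q ≡ q
  ind-refl v q with v ≟ v
  ... | yes _  = refl
  ... | no v≢v = ⊥-elim (v≢v refl)

  ind-≢ : ∀ {v w} q → v ≢ w → ind G v w q ≡ 0ℚ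
  ind-≢ {v} {w} q v≢w with v ≟ w
  ... | yes v≡w = ⊥-elim (v≢w v≡w)
  ... | no _    = refl

  ∑-ind : ∀ (c : C0 G ℚ) u q → sum (λ v → c v ℚ.* ind G v u q) ≡ c u ℚ.* q
  ∑-ind c u q =
    trans (sum-single _ u (λ v v≢u → trans (cong (c v ℚ.*_) (ind-≢ q v≢u)) (ℚP.*-zeroʳ (c v))))
          (cong (c u ℚ.*_) (ind-refl u q))

  d : C0 G ℚ → C1 G ℚ
  d c e = c (tgt e) ℚ.- c (src e)

  d*-adjoint : ∀ (c : C0 G ℚ) (x : C1 G ℚ) → sum (λ v → c v ℚ.* d* G x v) ≡ sum (λ e → d c e ℚ.* x e)
  d*-adjoint c x = begin
    sum (λ v → c v ℚ.* d* G x v)            ≡⟨ sum-cong-≗ (λ v → cong (c v ℚ.*_) (d*≡sum x v)) ⟩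
    sum (λ v → c v ℚ.* sum (t v))           ≡⟨ sum-cong-≗ (λ v → *-distribˡ-sum (c v) (t v)) ⟩
    sum (λ v → sum (λ e → c v ℚ.* t v e))   ≡⟨ ∑-comm (λ v e → c v ℚ.* t v e) ⟩
    sum (λ e → sum (λ v → c v ℚ.* t v e))   ≡⟨ sum-cong-≗ edge ⟩
    sum (λ e → d c e ℚ.* x e)               ∎
    where
    open ≡-Reasoning
    t = d*-term x
    at-tgt at-src : Fin m → Fin n → ℚ
    at-tgt e v = c v ℚ.* ind G v (tgt e) (x e)
    at-src e v = c v ℚ.* ind G v (src e) (ℚ.- x e)
    edge : ∀ e → sum (λ v → c v ℚ.* t v e) ≡ d c e ℚ.* x e
    edge e = begin
      sum (λ v → c v ℚ.* t v e)                     ≡⟨ sum-cong-≗ (λ v → ℚP.*-distribˡ-+ (c v) _ _) ⟩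
      sum (λ v → at-tgt e v ℚ.+ at-src e v)         ≡⟨ ∑-distrib-+ (at-tgt e) (at-src e) ⟩
      sum (at-tgt e) ℚ.+ sum (at-src e)
        ≡⟨ cong₂ ℚ._+_ (∑-ind c (tgt e) (x e)) (∑-ind c (src e) (ℚ.- x e)) ⟩
      c (tgt e) ℚ.* x e ℚ.+ c (src e) ℚ.* (ℚ.- x e)
        ≡⟨ solve 3 (λ p q y → p :* y :+ q :* (:- y) := (p :- q) :* y) refl (c (tgt e)) (c (src e)) (x e) ⟩
      d c e ℚ.* x e                                 ∎

  Box : C1 G ℚ → (Fin m → Set) → Fin m → ℚ → Set
  Box c A e x = Σ ℚ λ ε → ℚ.∣ ε ∣ ℚ.≤ ½ × (¬ A e → ε ≡ 0ℚ) × x ≡ c e ℚ.+ ε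

  InImage⇒Box : ∀ {c A y} → InImage G c A y →
                Σ (C1 G ℚ) λ x → (∀ e → Box c A e (x e)) × (∀ v → y v ≡ d* G x v)
  InImage⇒Box {c} (ε , ∣ε∣≤½ , ε≡0 , y≡) = (λ e → c e ℚ.+ ε e) , (λ e → ε e , ∣ε∣≤½ e , ε≡0 e , refl) , y≡

  Box⇒InImage : ∀ {c A y} x → (∀ e → Box c A e (x e)) → (∀ v → y v ≡ d* G x v) → InImage G c A y
  Box⇒InImage x x∈ y≡d*x = ε , ∣ε∣≤½ , ε≡0 , λ v → trans (y≡d*x v) (d*-cong x≡c+ε v)
    where
    ε     = λ e → proj₁ (x∈ e)
    ∣ε∣≤½ = λ e → proj₁ (proj₂ (x∈ e))
    ε≡0   = λ e → proj₁ (proj₂ (proj₂ (x∈ e)))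
    x≡c+ε = λ e → proj₂ (proj₂ (proj₂ (x∈ e)))

  InImage-mono : ∀ {c c′ A A′ y} → (∀ e {x} → Box c A e x → Box c′ A′ e x) →
                 InImage G c A y → InImage G c′ A′ y
  InImage-mono {c} {c′} {A} {A′} Box⊆Box′ y∈ with InImage⇒Box {c} {A} y∈
  ... | x , x∈ , y≡d*x = Box⇒InImage {c′} {A′} x (λ e → Box⊆Box′ e (x∈ e)) y≡d*x

  Box-cong : ∀ {c c′ A A′ e x} → c e ≡ c′ e → (A e → A′ e) → Box c A e x → Box c′ A′ e x
  Box-cong c≡c′ A⊆A′ (ε , ∣ε∣≤½ , ε≡0 , x≡) =
    ε , ∣ε∣≤½ , (λ ∉A′ → ε≡0 (∉A′ ∘ A⊆A′)) , trans x≡ (cong (ℚ._+ ε) c≡c′)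

  centre∈Box : ∀ c A e → Box c A e (c e)
  centre∈Box c A e = 0ℚ , ℚP.<⇒≤ (ℚP.positive⁻¹ ½) , (λ _ → refl) , sym (ℚP.+-identityʳ (c e))

  d*-centre∈InImage : ∀ c A → InImage G c A (d* G c)
  d*-centre∈InImage c A = Box⇒InImage {c} {A} c (centre∈Box c A) (λ _ → refl)

  χ-cases : ∀ (D : OEdge G → Bool) e →
            χ G D e ≡ 0ℚ ⊎ (χ G D e ≢ 0ℚ × ℚ.∣ ½ ℚ.* χ G D e ∣ ℚ.≤ ½ × Σ Bool λ b → D (e , b) ≡ true)
  χ-cases D e with D (e , true) in De | D (e , false) in Dē
  ... | true  | _     = inj₂ ((λ ()) , ℚP.≤-refl , true , De)
  ... | false | true  = inj₂ ((λ ()) , ℚP.≤-refl , false , Dē)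
  ... | false | false = inj₁ refl

  shifted-χ≡0 : ∀ 𝔪 f D e → χ G D e ≡ 0ℚ → shifted G 𝔪 f D e ≡ 𝔡 G 𝔪 f e
  shifted-χ≡0 𝔪 f D e χ≡0 = trans (cong (λ t → 𝔡 G 𝔪 f e ℚ.+ ½ ℚ.* t) χ≡0) (ℚP.+-identityʳ (𝔡 G 𝔪 f e))

  module _ (𝔪 : C1 G ℤ) (f : C0 G ℤ) (D : OEdge G → Bool) {A : Fin m → Set}
           (D⊆G : ∀ o → D o ≡ true → InG G 𝔪 f (proj₁ o))
           (A⊆G∩χ≡0 : ∀ e → A e → InG G 𝔪 f e × χ G D e ≡ 0ℚ) where

    face-Box⊆cell-Box : ∀ e {x} → Box (shifted G 𝔪 f D) A e x → Box (𝔡 G 𝔪 f) (InG G 𝔪 f) e x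
    face-Box⊆cell-Box e (ε , ∣ε∣≤½ , ε≡0 , x≡) =
      let ∣½χ+ε∣≤½ , ½χ+ε≡0 = admissible (χ-cases D e)
      in ½χ ℚ.+ ε , ∣½χ+ε∣≤½ , ½χ+ε≡0 , trans x≡ (ℚP.+-assoc (𝔡 G 𝔪 f e) ½χ ε)
      where
      ½χ = ½ ℚ.* χ G D e
      admissible : χ G D e ≡ 0ℚ ⊎ (χ G D e ≢ 0ℚ × ℚ.∣ ½χ ∣ ℚ.≤ ½ × Σ Bool λ b → D (e , b) ≡ true) →
                   ℚ.∣ ½χ ℚ.+ ε ∣ ℚ.≤ ½ × (¬ InG G 𝔪 f e → ½χ ℚ.+ ε ≡ 0ℚ)
      admissible (inj₁ χ≡0) =
          subst (λ t → ℚ.∣ t ∣ ℚ.≤ ½) (sym ½χ+ε≡ε) ∣ε∣≤½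
        , λ ∉G → trans ½χ+ε≡ε (ε≡0 (∉G ∘ proj₁ ∘ A⊆G∩χ≡0 e))
        where ½χ+ε≡ε = trans (cong (λ t → ½ ℚ.* t ℚ.+ ε) χ≡0) (ℚP.+-identityˡ ε)
      admissible (inj₂ (χ≢0 , ∣½χ∣≤½ , b , Deb≡true)) =
          subst (λ t → ℚ.∣ t ∣ ℚ.≤ ½) (sym ½χ+ε≡½χ) ∣½χ∣≤½
        , λ ∉G → ⊥-elim (∉G (D⊆G (e , b) Deb≡true))
        where ½χ+ε≡½χ = trans (cong (½χ ℚ.+_) (ε≡0 (χ≢0 ∘ proj₂ ∘ A⊆G∩χ≡0 e))) (ℚP.+-identityʳ ½χ)

    Face⊆Vor : ∀ {y} → InImage G (shifted G 𝔪 f D) A y → Vor G 𝔪 f y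
    Face⊆Vor = InImage-mono {shifted G 𝔪 f D} {𝔡 G 𝔪 f} {A} {InG G 𝔪 f} face-Box⊆cell-Box

-- Two Voronoi cells

module Intersection (G : MetricGraph) (𝔪 : C1 G ℤ) (f₁ f₂ : C0 G ℤ) where
  open MetricGraph G
  module I (e : Fin m) = EdgeInterval (ℓ e) {{ℓ-pos e}}
  open GroupProperties (AbelianGroup.group ℤP.+-0-abelianGroup) using (∙-cancelʳ)

  g : C0 G ℤ
  g v = f₂ v ℤ.- f₁ v

  ιg : C0 G ℚ
  ιg v = ι (g v)

  Flat : Fin m → Set
  Flat e = g (src e) ≡ g (tgt e)

  a₁ a₂ : Fin m → ℤ
  a₁ = aₑ G 𝔪 f₁
  a₂ = aₑ G 𝔪 f₂

  sh₁ sh₂ : C1 G ℚ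
  sh₁ = shifted G 𝔪 f₁ (D₁ G 𝔪 f₁ f₂)
  sh₂ = shifted G 𝔪 f₂ (D₂ G 𝔪 f₁ f₂)

  □₁ □₂ : Fin m → ℚ → Set
  □₁ = Box G (𝔡 G 𝔪 f₁) (InG G 𝔪 f₁)
  □₂ = Box G (𝔡 G 𝔪 f₂) (InG G 𝔪 f₂)

  Allowed₁ Allowed₂ : Fin m → Set
  Allowed₁ e = InG G 𝔪 f₁ e × Flat e
  Allowed₂ e = InG G 𝔪 f₂ e × Flat e

  Face₁ Face₂ Common : C0 G ℚ → Set
  Face₁ = Face G 𝔪 f₁ (D₁ G 𝔪 f₁ f₂) f₁ f₂
  Face₂ = Face G 𝔪 f₂ (D₂ G 𝔪 f₁ f₂) f₁ f₂
  Common y = Vor G 𝔪 f₁ y × Vor G 𝔪 f₂ y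

  a₁+g≡a₂+g : ∀ e → a₁ e ℤ.+ g (tgt e) ≡ a₂ e ℤ.+ g (src e)
  a₁+g≡a₂+g e = identity (f₁ (src e)) (f₁ (tgt e)) (f₂ (src e)) (f₂ (tgt e)) (𝔪 e)
    where identity : ∀ p q r s k → (q ℤ.- p ℤ.+ k) ℤ.+ (s ℤ.- q) ≡ (s ℤ.- r ℤ.+ k) ℤ.+ (r ℤ.- p)
          identity = ℤSolver.solve-∀

  ascending⇒a₁<a₂ : ∀ e → g (src e) ℤ.< g (tgt e) → a₁ e ℤ.< a₂ e
  ascending⇒a₁<a₂ e s<t = +-cancelʳ-< (g (src e))
    (subst (a₁ e ℤ.+ g (src e) ℤ.<_) (a₁+g≡a₂+g e) (ℤP.+-monoʳ-< (a₁ e) s<t))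

  descending⇒a₂<a₁ : ∀ e → g (tgt e) ℤ.< g (src e) → a₂ e ℤ.< a₁ e
  descending⇒a₂<a₁ e t<s = +-cancelʳ-< (g (tgt e))
    (subst (a₂ e ℤ.+ g (tgt e) ℤ.<_) (sym (a₁+g≡a₂+g e)) (ℤP.+-monoʳ-< (a₂ e) t<s))

  flat⇒a₁≡a₂ : ∀ e → Flat e → a₁ e ≡ a₂ e
  flat⇒a₁≡a₂ e s≡t =
    ∙-cancelʳ (g (tgt e)) (a₁ e) (a₂ e) (trans (a₁+g≡a₂+g e) (cong (λ t → a₂ e ℤ.+ t) s≡t))

  ascending-shifts : ∀ e → g (src e) ℤ.< g (tgt e) → sh₁ e ≡ I.hi e (a₁ e) × sh₂ e ≡ I.lo e (a₂ e)
  ascending-shifts e s<t = cong₂ (I.shiftedₑ e (a₁ e)) up dn , cong₂ (I.shiftedₑ e (a₂ e)) dn up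
    where up = dec-true (g (src e) ℤ.<? g (tgt e)) s<t
          dn = dec-false (g (tgt e) ℤ.<? g (src e)) (ℤP.<-asym s<t)

  descending-shifts : ∀ e → g (tgt e) ℤ.< g (src e) → sh₁ e ≡ I.lo e (a₁ e) × sh₂ e ≡ I.hi e (a₂ e)
  descending-shifts e t<s = cong₂ (I.shiftedₑ e (a₁ e)) up dn , cong₂ (I.shiftedₑ e (a₂ e)) dn up
    where up = dec-false (g (src e) ℤ.<? g (tgt e)) (ℤP.<-asym t<s)
          dn = dec-true (g (tgt e) ℤ.<? g (src e)) t<s

  flat-χ : ∀ e → Flat e → χ G (D₁ G 𝔪 f₁ f₂) e ≡ 0ℚ × χ G (D₂ G 𝔪 f₁ f₂) e ≡ 0ℚ
  flat-χ e s≡t = trans (cong₂ (I.χₑ e (a₁ e)) up dn) (I.χₑ-flat e (a₁ e))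
               , trans (cong₂ (I.χₑ e (a₂ e)) dn up) (I.χₑ-flat e (a₂ e))
    where up = dec-false (g (src e) ℤ.<? g (tgt e)) (ℤP.<-irrefl s≡t)
          dn = dec-false (g (tgt e) ℤ.<? g (src e)) (ℤP.<-irrefl (sym s≡t))

  flat-shifts : ∀ e → Flat e → sh₁ e ≡ 𝔡 G 𝔪 f₁ e × sh₂ e ≡ 𝔡 G 𝔪 f₂ e
  flat-shifts e s≡t = shifted-χ≡0 G 𝔪 f₁ (D₁ G 𝔪 f₁ f₂) e (proj₁ (flat-χ e s≡t))
                    , shifted-χ≡0 G 𝔪 f₂ (D₂ G 𝔪 f₁ f₂) e (proj₂ (flat-χ e s≡t))

  □-bounds : ∀ {f} e {x} → Box G (𝔡 G 𝔪 f) (InG G 𝔪 f) e x →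
             I.lo e (aₑ G 𝔪 f e) ℚ.≤ x × x ℚ.≤ I.hi e (aₑ G 𝔪 f e)
  □-bounds {f} e (ε , ∣ε∣≤½ , ε≡0 , refl) = I.lo≤𝔡+ε≤hi e (aₑ G 𝔪 f e) ∣ε∣≤½ ε≡0

  dιg-pos : ∀ e → g (src e) ℤ.< g (tgt e) → ℚ.Positive (d G ιg e)
  dιg-pos e s<t = ℚ.positive (p<q⇒0<q-p (ι-mono-< s<t))

  dιg-neg : ∀ e → g (tgt e) ℤ.< g (src e) → ℚ.Negative (d G ιg e)
  dιg-neg e t<s = ℚ.negative (p<q⇒p-q<0 (ι-mono-< t<s))

  dιg-flat : ∀ e → Flat e → d G ιg e ≡ 0ℚ
  dιg-flat e s≡t = trans (cong (λ t → ιg (tgt e) ℚ.- ι t) s≡t) (ℚP.+-inverseʳ (ιg (tgt e)))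

  module _ (e : Fin m) {x₁ x₂ : ℚ} (x₁∈□₁ : □₁ e x₁) (x₂∈□₂ : □₂ e x₂) where

    ascending : g (src e) ℤ.< g (tgt e) → x₁ ℚ.≤ sh₁ e × sh₁ e ℚ.≤ sh₂ e × sh₂ e ℚ.≤ x₂
    ascending s<t rewrite proj₁ (ascending-shifts e s<t) | proj₂ (ascending-shifts e s<t) =
      proj₂ (□-bounds {f₁} e x₁∈□₁) , I.hi≤lo e (ascending⇒a₁<a₂ e s<t) , proj₁ (□-bounds {f₂} e x₂∈□₂)

    descending : g (tgt e) ℤ.< g (src e) → x₂ ℚ.≤ sh₂ e × sh₂ e ℚ.≤ sh₁ e × sh₁ e ℚ.≤ x₁
    descending t<s rewrite proj₁ (descending-shifts e t<s) | proj₂ (descending-shifts e t<s) =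
      proj₂ (□-bounds {f₂} e x₂∈□₂) , I.hi≤lo e (descending⇒a₂<a₁ e t<s) , proj₁ (□-bounds {f₁} e x₁∈□₁)

    term-≤ : d G ιg e ℚ.* x₁ ℚ.≤ d G ιg e ℚ.* x₂
    term-≤ with ℤP.<-cmp (g (src e)) (g (tgt e))
    ... | tri< s<t _ _ = let instance _ = ℚP.pos⇒nonNeg (d G ιg e) {{dιg-pos e s<t}}
                             x₁≤sh₁ , sh₁≤sh₂ , sh₂≤x₂ = ascending s<t
                         in ℚP.*-monoˡ-≤-nonNeg (d G ιg e) (ℚP.≤-trans x₁≤sh₁ (ℚP.≤-trans sh₁≤sh₂ sh₂≤x₂))
    ... | tri≈ _ s≡t _ = ℚP.≤-reflexive (trans (vanishes x₁) (sym (vanishes x₂)))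
      where vanishes : ∀ x → d G ιg e ℚ.* x ≡ 0ℚ
            vanishes x = trans (cong (ℚ._* x) (dιg-flat e s≡t)) (ℚP.*-zeroˡ x)
    ... | tri> _ _ t<s = let instance _ = ℚP.neg⇒nonPos (d G ιg e) {{dιg-neg e t<s}}
                             x₂≤sh₂ , sh₂≤sh₁ , sh₁≤x₁ = descending t<s
                         in ℚP.*-monoˡ-≤-nonPos (d G ιg e) (ℚP.≤-trans x₂≤sh₂ (ℚP.≤-trans sh₂≤sh₁ sh₁≤x₁))

    term-≡⇒shifts-agree : d G ιg e ℚ.* x₁ ≡ d G ιg e ℚ.* x₂ → ¬ Flat e → sh₁ e ≡ x₁ × sh₂ e ≡ x₁
    term-≡⇒shifts-agree terms≡ ¬flat with ℤP.<-cmp (g (src e)) (g (tgt e))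
    ... | tri< s<t _ _ = let instance _ = ℚP.pos⇒nonZero (d G ιg e) {{dιg-pos e s<t}}
                             x₁≡x₂ = *-cancelˡ-≡ (d G ιg e) terms≡
                             x₁≤sh₁ , sh₁≤sh₂ , sh₂≤x₂ = ascending s<t
                             x₁≡sh₁ , sh₂≡x₂ = squeeze x₁≤sh₁ sh₁≤sh₂ sh₂≤x₂ x₁≡x₂
                         in sym x₁≡sh₁ , trans sh₂≡x₂ (sym x₁≡x₂)
    ... | tri≈ _ s≡t _ = ⊥-elim (¬flat s≡t)
    ... | tri> _ _ t<s = let instance _ = ℚP.neg⇒nonZero (d G ιg e) {{dιg-neg e t<s}}
                             x₁≡x₂ = *-cancelˡ-≡ (d G ιg e) terms≡
                             x₂≤sh₂ , sh₂≤sh₁ , sh₁≤x₁ = descending t<s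
                             x₂≡sh₂ , sh₁≡x₁ = squeeze x₂≤sh₂ sh₂≤sh₁ sh₁≤x₁ (sym x₁≡x₂)
                         in sh₁≡x₁ , trans (sym x₂≡sh₂) (sym x₁≡x₂)

  non-flat-agree : ∀ {x₁ x₂ : C1 G ℚ} → (∀ e → □₁ e (x₁ e)) → (∀ e → □₂ e (x₂ e)) →
                   (∀ v → d* G x₁ v ≡ d* G x₂ v) → ∀ e → ¬ Flat e → sh₁ e ≡ x₁ e × sh₂ e ≡ x₁ e
  non-flat-agree {x₁} {x₂} x₁∈□₁ x₂∈□₂ d*x₁≡d*x₂ e =
    term-≡⇒shifts-agree e (x₁∈□₁ e) (x₂∈□₂ e) (∑-≤∧≡⇒≡ (λ e → term-≤ e (x₁∈□₁ e) (x₂∈□₂ e)) ∑≡∑ e)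
    where
    ∑≡∑ : sum (λ e → d G ιg e ℚ.* x₁ e) ≡ sum (λ e → d G ιg e ℚ.* x₂ e)
    ∑≡∑ = begin
      sum (λ e → d G ιg e ℚ.* x₁ e)   ≡⟨ d*-adjoint G ιg x₁ ⟨
      sum (λ v → ιg v ℚ.* d* G x₁ v)  ≡⟨ sum-cong-≗ (λ v → cong (ιg v ℚ.*_) (d*x₁≡d*x₂ v)) ⟩
      sum (λ v → ιg v ℚ.* d* G x₂ v)  ≡⟨ d*-adjoint G ιg x₂ ⟩
      sum (λ e → d G ιg e ℚ.* x₂ e)   ∎
      where open ≡-Reasoning

  Common⇒□₁×□₂ : ∀ {y} → Common y → Σ (C1 G ℚ) λ x₁ → Σ (C1 G ℚ) λ x₂ →
                 (∀ e → □₁ e (x₁ e)) × (∀ e → □₂ e (x₂ e)) ×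
                 (∀ v → y v ≡ d* G x₁ v) × (∀ v → d* G x₁ v ≡ d* G x₂ v)
  Common⇒□₁×□₂ (y∈Vor₁ , y∈Vor₂) with InImage⇒Box G {𝔡 G 𝔪 f₁} {InG G 𝔪 f₁} y∈Vor₁
                                    | InImage⇒Box G {𝔡 G 𝔪 f₂} {InG G 𝔪 f₂} y∈Vor₂
  ... | x₁ , x₁∈□₁ , y≡d*x₁ | x₂ , x₂∈□₂ , y≡d*x₂ =
    x₁ , x₂ , x₁∈□₁ , x₂∈□₂ , y≡d*x₁ , λ v → trans (sym (y≡d*x₁ v)) (y≡d*x₂ v)

  common⇒shifts-agree : Σ (C0 G ℚ) Common → ∀ e → sh₁ e ≡ sh₂ e
  common⇒shifts-agree (y , y∈) e with Common⇒□₁×□₂ y∈ | g (src e) ℤ.≟ g (tgt e)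
  ... | _ | yes flat = let sh₁≡𝔡₁ , sh₂≡𝔡₂ = flat-shifts e flat
                       in trans sh₁≡𝔡₁ (trans (cong (I.𝔡ₑ e) (flat⇒a₁≡a₂ e flat)) (sym sh₂≡𝔡₂))
  ... | x₁ , x₂ , x₁∈□₁ , x₂∈□₂ , _ , d*x₁≡d*x₂ | no ¬flat =
    let sh₁≡x₁ , sh₂≡x₁ = non-flat-agree x₁∈□₁ x₂∈□₂ d*x₁≡d*x₂ e ¬flat in trans sh₁≡x₁ (sym sh₂≡x₁)

  Common⊆Face₁ : ∀ {y} → Common y → Face₁ y
  Common⊆Face₁ y∈ with Common⇒□₁×□₂ y∈
  ... | x₁ , x₂ , x₁∈□₁ , x₂∈□₂ , y≡d*x₁ , d*x₁≡d*x₂ = Box⇒InImage G {sh₁} {Allowed₁} x₁ x₁∈face y≡d*x₁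
    where
    x₁∈face : ∀ e → Box G sh₁ Allowed₁ e (x₁ e)
    x₁∈face e with g (src e) ℤ.≟ g (tgt e)
    ... | yes flat = let ε , ∣ε∣≤½ , ε≡0 , x₁≡𝔡₁+ε = x₁∈□₁ e
                     in ε , ∣ε∣≤½ , (λ ∉face → ε≡0 (λ ∈G → ∉face (∈G , flat)))
                      , trans x₁≡𝔡₁+ε (cong (ℚ._+ ε) (sym (proj₁ (flat-shifts e flat))))
    ... | no ¬flat = subst (Box G sh₁ Allowed₁ e) (proj₁ (non-flat-agree x₁∈□₁ x₂∈□₂ d*x₁≡d*x₂ e ¬flat))
                           (centre∈Box G sh₁ Allowed₁ e)

  Face₁⇔Face₂ : (∀ e → sh₁ e ≡ sh₂ e) → ∀ y → Face₁ y ⇔ Face₂ y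
  Face₁⇔Face₂ sh₁≡sh₂ y = mk⇔
    (InImage-mono G {sh₁} {sh₂} {Allowed₁} {Allowed₂}
      (λ e → Box-cong G {sh₁} {sh₂} {Allowed₁} {Allowed₂} (sh₁≡sh₂ e) (Allowed₁⊆Allowed₂ e)))
    (InImage-mono G {sh₂} {sh₁} {Allowed₂} {Allowed₁}
      (λ e → Box-cong G {sh₂} {sh₁} {Allowed₂} {Allowed₁} (sym (sh₁≡sh₂ e)) (Allowed₂⊆Allowed₁ e)))
    where
    Allowed₁⊆Allowed₂ : ∀ e → Allowed₁ e → Allowed₂ e
    Allowed₁⊆Allowed₂ e (∈G₁ , flat) = subst (λ a → ℓ e ∣ℕ ℤ.∣ a ∣) (flat⇒a₁≡a₂ e flat) ∈G₁ , flat
    Allowed₂⊆Allowed₁ : ∀ e → Allowed₂ e → Allowed₁ e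
    Allowed₂⊆Allowed₁ e (∈G₂ , flat) = subst (λ a → ℓ e ∣ℕ ℤ.∣ a ∣) (sym (flat⇒a₁≡a₂ e flat)) ∈G₂ , flat

  Face₁⊆Vor₁ : ∀ {y} → Face₁ y → Vor G 𝔪 f₁ y
  Face₁⊆Vor₁ = Face⊆Vor G 𝔪 f₁ (D₁ G 𝔪 f₁ f₂) (λ (e , _) → ∧-true⇒witness (ℓ e ∣? ℤ.∣ a₁ e ∣))
                        (λ e (∈G₁ , flat) → ∈G₁ , proj₁ (flat-χ e flat))

  Face₂⊆Vor₂ : ∀ {y} → Face₂ y → Vor G 𝔪 f₂ y
  Face₂⊆Vor₂ = Face⊆Vor G 𝔪 f₂ (D₂ G 𝔪 f₁ f₂) (λ (e , _) → ∧-true⇒witness (ℓ e ∣? ℤ.∣ a₂ e ∣))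
                        (λ e (∈G₂ , flat) → ∈G₂ , proj₂ (flat-χ e flat))

  Face₁⇔Common : (∀ e → sh₁ e ≡ sh₂ e) → ∀ y → Face₁ y ⇔ Common y
  Face₁⇔Common sh₁≡sh₂ y = mk⇔
    (λ y∈ → Face₁⊆Vor₁ y∈ , Face₂⊆Vor₂ (Equivalence.to (Face₁⇔Face₂ sh₁≡sh₂ y) y∈))
    Common⊆Face₁

  shifts-agree⇒common : (∀ e → sh₁ e ≡ sh₂ e) → Σ (C0 G ℚ) Common
  shifts-agree⇒common sh₁≡sh₂ =
    d* G sh₁ , Equivalence.to (Face₁⇔Common sh₁≡sh₂ _) (d*-centre∈InImage G sh₁ Allowed₁)

proposition5p12 : (G : MetricGraph) → Connected G
    → (𝔪 : C1 G ℤ) (f₁ f₂ : C0 G ℤ)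
    → ConnectedSub G (InG G 𝔪 f₁) → ConnectedSub G (InG G 𝔪 f₂)
    → ((Σ (C0 G ℚ) λ y → Vor G 𝔪 f₁ y × Vor G 𝔪 f₂ y)
         ⇔ (∀ e → shifted G 𝔪 f₁ (D₁ G 𝔪 f₁ f₂) e ≡ shifted G 𝔪 f₂ (D₂ G 𝔪 f₁ f₂) e))
      × ((∀ e → shifted G 𝔪 f₁ (D₁ G 𝔪 f₁ f₂) e ≡ shifted G 𝔪 f₂ (D₂ G 𝔪 f₁ f₂) e)
         → ∀ y → (Face G 𝔪 f₁ (D₁ G 𝔪 f₁ f₂) f₁ f₂ y ⇔ (Vor G 𝔪 f₁ y × Vor G 𝔪 f₂ y))
               × (Face G 𝔪 f₂ (D₂ G 𝔪 f₁ f₂) f₁ f₂ y ⇔ (Vor G 𝔪 f₁ y × Vor G 𝔪 f₂ y)))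
proposition5p12 G _ 𝔪 f₁ f₂ _ _ =
    mk⇔ common⇒shifts-agree shifts-agree⇒common
  , λ sh₁≡sh₂ y → Face₁⇔Common sh₁≡sh₂ y , Face₁⇔Common sh₁≡sh₂ y ⇔-∘ ⇔-sym (Face₁⇔Face₂ sh₁≡sh₂ y)
  where open Intersection G 𝔪 f₁ f₂
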